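{- Let $p,q,a_0,a_1$ be integers with $\Delta=p^2+4q>0$, $(w_k)_{k\ge0}$ the Horadam sequence $w_0=a_0$, $w_1=a_1$, $w_{k+1}=pw_k+qw_{k-1}$, $\alpha=\frac{p+\sqrt\Delta}{2}$, $\beta=\frac{p-\sqrt\Delta}{2}$, $A=a_1-a_0\beta$, $B=a_1-a_0\alpha$. Let $N\ge1$, $K$ a field containing $\mathbb{R}$ and a primitive $N$-th root of unity $\omega$, $a,b\in K^*$, $S=\big(\frac{a,b}{K,\omega}\big)$ with ordered basis $e_0,\dots,e_{N^2-1}$, $W_k=\sum_{l=0}^{N^2-1}w_{k+l}e_l$, $\underline\alpha=\sum_l\alpha^le_l$, $\underline\beta=\sum_l\beta^le_l$. Then for all natural numbers (positive integers) $m,n$, $$W_mW_{n+1}+qW_{m-1}W_n=\frac{A^2\underline\alpha^2\alpha^{m+n}-B^2\underline\beta^2\beta^{m+n}}{\alpha-\beta}.$$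
   Context: The symbol algebra $\big(\frac{a,b}{K,\omega}\big)$ is the associative $K$-algebra generated by $x,y$ with $x^N=a$, $y^N=b$, $yx=\omega xy$, with $K$-basis $\{x^iy^j:0\le i,j<N\}$ ordered as $e_{jN+i}=x^iy^j$; $\underline\alpha^2=\underline\alpha\,\underline\alpha$ in $S$. -}

module Defs where

open import Level using (Level; _⊔_) renaming (suc to lsuc)
open import Algebra.Bundles using (CommutativeRing; Semiring)
open import Data.Nat as ℕ using (ℕ; zero; suc; NonZero; _%_)
open import Data.Integer as ℤ using (ℤ; +_; -[1+_])
open import Data.Fin using (Fin; toℕ)
open import Data.Product using (_×_)
open import Relation.Nullary using (¬_; does)
open import Relation.Binary.PropositionalEquality using (_≡_)
open import Data.Bool using (if_then_else_)

record Field c ℓ : Set (lsuc (c ⊔ ℓ)) where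
  field
    commutativeRing : CommutativeRing c ℓ
  open CommutativeRing commutativeRing public
  field
    _⁻¹        : Carrier → Carrier
    ⁻¹-inverse : ∀ x → ¬ (x ≈ 0#) → (x * (x ⁻¹)) ≈ 1#
    0≉1        : ¬ (0# ≈ 1#)

horadam : (p q a₀ a₁ : ℤ) → ℕ → ℤ
horadam p q a₀ a₁ zero = a₀
horadam p q a₀ a₁ (suc zero) = a₁
horadam p q a₀ a₁ (suc (suc k)) =
  p ℤ.* horadam p q a₀ a₁ (suc k) ℤ.+ q ℤ.* horadam p q a₀ a₁ k

disc : ℤ → ℤ → ℤ
disc p q = p ℤ.* p ℤ.+ (+ 4) ℤ.* q

module FieldOps {c ℓ} (K : Field c ℓ) where
  open Field K
  open import Algebra.Definitions.RawSemiring (Semiring.rawSemiring semiring) public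
    using (_^_) renaming (_×_ to _·ℕ_)

  ι : ℤ → Carrier
  ι (+ n)    = n ·ℕ 1#
  ι -[1+ n ] = - (suc n ·ℕ 1#)

  -- characteristic zero (K contains ℝ, hence ℚ)
  CharZero : Set (ℓ)
  CharZero = ∀ n → (n ·ℕ 1#) ≈ 0# → n ≡ 0

  PrimitiveRoot : ℕ → Carrier → Set ℓ
  PrimitiveRoot N ω = ((ω ^ N) ≈ 1#) × (∀ k → 0 ℕ.< k → k ℕ.< N → ¬ ((ω ^ k) ≈ 1#))

  sumFin : ∀ n → (Fin n → Carrier) → Carrier
  sumFin zero    f = 0#
  sumFin (suc n) f = f Fin.zero + sumFin n (λ i → f (Fin.suc i))
    where import Data.Fin as Fin

  -- The symbol algebra (a,b / K,ω): an element is its coordinate vector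
  -- u i j = coefficient of x^i y^j (= coefficient of e_{jN+i}), 0 ≤ i,j < N.
  module SymbolAlgebra (N : ℕ) {{_ : NonZero N}} (ω a b : Carrier) where

    S : Set c
    S = Fin N → Fin N → Carrier

    _⊕_ : S → S → S
    (u ⊕ v) i j = u i j + v i j

    _⊖_ : S → S → S
    (u ⊖ v) i j = u i j - v i j

    _·_ : Carrier → S → S
    (k · u) i j = k * u i j

    -- coordinate (i,j) of the product of basis elements
    --   (x^i₁ y^j₁)(x^i₂ y^j₂) = ω^(j₁ i₂) x^(i₁+i₂) y^(j₁+j₂),
    -- reduced with x^N = a, y^N = b.
    basisProd : (i₁ j₁ i₂ j₂ i j : Fin N) → Carrier
    basisProd i₁ j₁ i₂ j₂ i j =
      if does (toℕ i ℕ.≟ (toℕ i₁ ℕ.+ toℕ i₂) % N)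
         Data.Bool.∧ does (toℕ j ℕ.≟ (toℕ j₁ ℕ.+ toℕ j₂) % N)
      then (ω ^ (toℕ j₁ ℕ.* toℕ i₂))
           * ((if does (N ℕ.≤? toℕ i₁ ℕ.+ toℕ i₂) then a else 1#)
           * (if does (N ℕ.≤? toℕ j₁ ℕ.+ toℕ j₂) then b else 1#))
      else 0#
      where import Data.Bool

    _⊗_ : S → S → S
    (u ⊗ v) i j =
      sumFin N λ i₁ → sumFin N λ j₁ → sumFin N λ i₂ → sumFin N λ j₂ →
        (u i₁ j₁ * v i₂ j₂) * basisProd i₁ j₁ i₂ j₂ i j

    _≋_ : S → S → Set ℓ
    u ≋ v = ∀ i j → u i j ≈ v i j

    -- Σ_{l=0}^{N²-1} f(l) e_l, with e_{jN+i} = x^i y^j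
    fromSeq : (ℕ → Carrier) → S
    fromSeq f i j = f (toℕ j ℕ.* N ℕ.+ toℕ i)

-- With α, β the roots of x² − p x − q, Binet's formula gives
-- w_k = (A α^k − B β^k)/(α − β), so W_k = c A α^k α̲ − c B β^k β̲ with
-- c = (α − β)⁻¹. Expanding W_m W_{n+1} + q W_{m−1} W_n by bilinearity of the
-- product of S, each of the four coefficients has the shape
-- x y ρ^(m−1) σ^n (ρ σ + q) with ρ, σ ∈ {α, β}. Since q = −αβ the mixed
-- coefficients vanish, while α² + q = α(α − β) and β² + q = −β(α − β) leave
-- exactly the right-hand side.
module Submission where

open import Defs
open import Level using (Level)
open import Data.Nat as ℕ using (ℕ; NonZero; zero; suc)
open import Data.Integer as ℤ using (ℤ; +_; -[1+_])
open import Data.Fin as Fin using (Fin)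
open import Data.Product using (_×_; _,_; proj₁)
open import Data.Maybe using (Maybe; just; nothing)
open import Relation.Nullary using (¬_; yes; no)
import Data.Integer.Properties as ℤ
import Data.Nat.Properties as ℕ
import Relation.Binary.PropositionalEquality as ≡
open import Algebra.Solver.Ring.AlmostCommutativeRing
  using (fromCommutativeRing; _-Raw-AlmostCommutative⟶_)
import Algebra.Properties.Ring as RingProperties
import Algebra.Properties.Semiring.Mult as SemiringMult
import Algebra.Properties.Semiring.Exp as SemiringExp

module IntegerEmbedding {r ℓ} (K : Field r ℓ) where
  open Field K
  open FieldOps K
  open RingProperties ring using (-‿involutive; -0#≈0#; -‿+-comm; -‿distribˡ-*)
  open SemiringMult semiring using (×-homo-+)
  open import Relation.Binary.Reasoning.Setoid setoid

  ι-‿homo : ∀ i → ι (ℤ.- i) ≈ - ι i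
  ι-‿homo -[1+ n ]   = sym (-‿involutive _)
  ι-‿homo (+ zero)   = sym -0#≈0#
  ι-‿homo (+ suc n)  = refl

  ι-⊖-homo : ∀ m n → ι (m ℤ.⊖ n) ≈ ι (+ m) - ι (+ n)
  ι-⊖-homo zero    zero    = sym (-‿inverseʳ 0#)
  ι-⊖-homo zero    (suc n) = sym (+-identityˡ _)
  ι-⊖-homo (suc m) zero    = sym (trans (+-congˡ -0#≈0#) (+-identityʳ _))
  ι-⊖-homo (suc m) (suc n) = begin
    ι (suc m ℤ.⊖ suc n)          ≡⟨ ≡.cong ι (ℤ.[1+m]⊖[1+n]≡m⊖n m n) ⟩
    ι (m ℤ.⊖ n)                  ≈⟨ ι-⊖-homo m n ⟩
    x - y                        ≈⟨ +-congʳ (+-identityˡ x) ⟨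
    (0# + x) - y                 ≈⟨ +-congʳ (+-congʳ (-‿inverseʳ 1#)) ⟨
    ((1# - 1#) + x) - y          ≈⟨ +-congʳ (+-assoc 1# (- 1#) x) ⟩
    (1# + (- 1# + x)) - y        ≈⟨ +-congʳ (+-congˡ (+-comm (- 1#) x)) ⟩
    (1# + (x - 1#)) - y          ≈⟨ +-congʳ (+-assoc 1# x (- 1#)) ⟨
    ((1# + x) - 1#) - y          ≈⟨ +-assoc (1# + x) (- 1#) (- y) ⟩
    (1# + x) + (- 1# - y)        ≈⟨ +-congˡ (-‿+-comm 1# y) ⟩
    (1# + x) - (1# + y)          ∎
    where
    x = ι (+ m)
    y = ι (+ n)

  ι-+-homo : ∀ i j → ι (i ℤ.+ j) ≈ ι i + ι j
  ι-+-homo -[1+ m ] -[1+ n ] = begin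
    - (suc (suc (m ℕ.+ n)) ·ℕ 1#)   ≡⟨ ≡.cong (λ k → - (suc k ·ℕ 1#)) (ℕ.+-suc m n) ⟨
    - ((suc m ℕ.+ suc n) ·ℕ 1#)     ≈⟨ -‿cong (×-homo-+ 1# (suc m) (suc n)) ⟩
    - (suc m ·ℕ 1# + suc n ·ℕ 1#)   ≈⟨ -‿+-comm _ _ ⟨
    - (suc m ·ℕ 1#) - (suc n ·ℕ 1#) ∎
  ι-+-homo -[1+ m ] (+ n)    = trans (ι-⊖-homo n (suc m)) (+-comm _ _)
  ι-+-homo (+ m)    -[1+ n ] = ι-⊖-homo m (suc n)
  ι-+-homo (+ m)    (+ n)    = ×-homo-+ 1# m n

  ι-*-homo⁺ : ∀ m j → ι (+ m ℤ.* j) ≈ ι (+ m) * ι j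
  ι-*-homo⁺ zero    j = trans (reflexive (≡.cong ι (ℤ.*-zeroˡ j))) (sym (zeroˡ _))
  ι-*-homo⁺ (suc m) j = begin
    ι (+ suc m ℤ.* j)             ≡⟨ ≡.cong ι (ℤ.suc-* (+ m) j) ⟩
    ι (j ℤ.+ + m ℤ.* j)           ≈⟨ ι-+-homo j (+ m ℤ.* j) ⟩
    ι j + ι (+ m ℤ.* j)           ≈⟨ +-cong (sym (*-identityˡ _)) (ι-*-homo⁺ m j) ⟩
    1# * ι j + ι (+ m) * ι j      ≈⟨ distribʳ _ _ _ ⟨
    (1# + ι (+ m)) * ι j          ∎

  ι-*-homo : ∀ i j → ι (i ℤ.* j) ≈ ι i * ι j
  ι-*-homo (+ m)    j = ι-*-homo⁺ m j
  ι-*-homo -[1+ m ] j = begin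
    ι (-[1+ m ] ℤ.* j)          ≡⟨ ≡.cong ι (ℤ.neg-distribˡ-* (+ suc m) j) ⟨
    ι (ℤ.- (+ suc m ℤ.* j))     ≈⟨ ι-‿homo (+ suc m ℤ.* j) ⟩
    - ι (+ suc m ℤ.* j)         ≈⟨ -‿cong (ι-*-homo⁺ (suc m) j) ⟩
    - (ι (+ suc m) * ι j)       ≈⟨ -‿distribˡ-* _ _ ⟩
    - ι (+ suc m) * ι j         ∎

  ι-homomorphism : ℤ.+-*-rawRing -Raw-AlmostCommutative⟶ fromCommutativeRing commutativeRing
  ι-homomorphism = record
    { ⟦_⟧ = ι ; +-homo = ι-+-homo ; *-homo = ι-*-homo ; -‿homo = ι-‿homo
    ; 0-homo = refl ; 1-homo = +-identityʳ 1# }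

  ι-≟ : ∀ i j → Maybe (ι i ≈ ι j)
  ι-≟ i j with i ℤ.≟ j
  ... | yes ≡.refl = just refl
  ... | no _       = nothing

  ι-pos≉0 : CharZero → ∀ d → ℤ.0ℤ ℤ.< d → ¬ (ι d ≈ 0#)
  ι-pos≉0 charZero (+ zero)  (ℤ.+<+ ())
  ι-pos≉0 charZero (+ suc k) _ ι[d]≈0 with charZero (suc k) ι[d]≈0
  ... | ()

module FieldIdentities {r ℓ} (K : Field r ℓ) where
  open Field K
  open FieldOps K
  open IntegerEmbedding K
  open SemiringExp semiring using (^-homo-*)
  open RingProperties ring using (-‿involutive; -‿distribˡ-*)
  open import Relation.Binary.Reasoning.Setoid setoid
  open import Algebra.Solver.Ring ℤ.+-*-rawRing (fromCommutativeRing commutativeRing)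
    ι-homomorphism ι-≟

  binet : (w : ℕ → Carrier) (α β x y : Carrier) →
          w 0 ≈ x + y → w 1 ≈ x * α ^ 1 + y * β ^ 1 →
          (∀ k → w (suc (suc k)) ≈ (α + β) * w (suc k) - (α * β) * w k) →
          ∀ k → w k ≈ x * α ^ k + y * β ^ k
  binet w α β x y w₀ w₁ rec = λ k → proj₁ (consecutive k)
    where
    formula : ℕ → Set ℓ
    formula k = w k ≈ x * α ^ k + y * β ^ k
    consecutive : ∀ k → formula k × formula (suc k)
    consecutive zero    = trans w₀ (+-cong (sym (*-identityʳ x)) (sym (*-identityʳ y))) , w₁
    consecutive (suc k) with consecutive k
    ... | wₖ , wₖ₊₁ = wₖ₊₁ , (begin
      w (suc (suc k))                                        ≈⟨ rec k ⟩
      (α + β) * w (suc k) - (α * β) * w k                    ≈⟨ +-cong (*-congˡ wₖ₊₁) (-‿cong (*-congˡ wₖ)) ⟩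
      (α + β) * (x * (α * α ^ k) + y * (β * β ^ k))
        - (α * β) * (x * α ^ k + y * β ^ k)                  ≈⟨ solve 6 (λ α β x y a b →
           (α :+ β) :* (x :* (α :* a) :+ y :* (β :* b)) :- (α :* β) :* (x :* a :+ y :* b)
           := x :* (α :* (α :* a)) :+ y :* (β :* (β :* b))) refl α β x y (α ^ k) (β ^ k) ⟩
      x * (α * (α * α ^ k)) + y * (β * (β * β ^ k))          ∎)

  sumFin-linear : ∀ n {f g h : Fin n → Carrier} x y →
                  (∀ i → f i ≈ x * g i + y * h i) →
                  sumFin n f ≈ x * sumFin n g + y * sumFin n h
  sumFin-linear zero    x y _  = solve 2 (λ x y → con (+ 0) := x :* con (+ 0) :+ y :* con (+ 0)) refl x y
  sumFin-linear (suc n) {g = g} {h} x y fᵢ≈ = begin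
    _ + sumFin n _                                         ≈⟨ +-cong (fᵢ≈ Fin.zero)
                                                                (sumFin-linear n x y (λ i → fᵢ≈ (Fin.suc i))) ⟩
    (x * g Fin.zero + y * h Fin.zero) + (x * G + y * H)    ≈⟨ solve 6 (λ x y g₀ h₀ G H →
       (x :* g₀ :+ y :* h₀) :+ (x :* G :+ y :* H) := x :* (g₀ :+ G) :+ y :* (h₀ :+ H))
       refl x y (g Fin.zero) (h Fin.zero) G H ⟩
    x * (g Fin.zero + G) + y * (h Fin.zero + H)            ∎
    where
    G H : Carrier
    G = sumFin n (λ i → g (Fin.suc i))
    H = sumFin n (λ i → h (Fin.suc i))

  binet-product-identity : ∀ (α β x y X Y Z T : Carrier) m n →
    let e = λ k → x * α ^ k
        f = λ k → y * β ^ k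
        Q = λ k l → ((e k * e l) * X + (e k * f l) * Y) + ((f k * e l) * Z + (f k * f l) * T)
    in Q (suc m) (suc n) + (- (α * β)) * Q m n
         ≈ (α - β) * ((x * x) * α ^ (suc m ℕ.+ n) * X - (y * y) * β ^ (suc m ℕ.+ n) * T)
  binet-product-identity α β x y X Y Z T m n = begin
    _   ≈⟨ solve 12 (λ α β x y a a₂ b b₂ X Y Z T →
             let e₁ = x :* (α :* a) ; e₂ = x :* (α :* a₂) ; f₁ = y :* (β :* b) ; f₂ = y :* (β :* b₂)
             in ((e₁ :* e₂) :* X :+ (e₁ :* f₂) :* Y) :+ ((f₁ :* e₂) :* Z :+ (f₁ :* f₂) :* T)
                :+ (:- (α :* β)) :* ((((x :* a) :* (x :* a₂)) :* X :+ ((x :* a) :* (y :* b₂)) :* Y)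
                                     :+ (((y :* b) :* (x :* a₂)) :* Z :+ ((y :* b) :* (y :* b₂)) :* T))
             := (α :- β) :* ((x :* x) :* (α :* (a :* a₂)) :* X :- (y :* y) :* (β :* (b :* b₂)) :* T))
           refl α β x y (α ^ m) (α ^ n) (β ^ m) (β ^ n) X Y Z T ⟩
    (α - β) * ((x * x) * (α * (α ^ m * α ^ n)) * X - (y * y) * (β * (β ^ m * β ^ n)) * T)
        ≈⟨ *-congˡ (+-cong (*-congʳ (*-congˡ (*-congˡ (^-homo-* α m n))))
                           (-‿cong (*-congʳ (*-congˡ (*-congˡ (^-homo-* β m n)))))) ⟨
    (α - β) * ((x * x) * α ^ (suc m ℕ.+ n) * X - (y * y) * β ^ (suc m ℕ.+ n) * T) ∎

  module QuadraticRoots (charZero : CharZero) (p q : ℤ)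
                        (s : Carrier) (s²≈Δ : s * s ≈ ι (disc p q)) where
    two half α β : Carrier
    two = 1# + 1#
    half = two ⁻¹
    α = (ι p + s) * half
    β = (ι p - s) * half

    two*half≈1 : ι (+ 2) * half ≈ 1#
    two*half≈1 = trans (*-congʳ (+-congˡ (+-identityʳ 1#))) (⁻¹-inverse two two≉0)
      where
      two≉0 : ¬ (two ≈ 0#)
      two≉0 two≈0 with charZero 2 (trans (+-congˡ (+-identityʳ 1#)) two≈0)
      ... | ()

    α+β≈p : α + β ≈ ι p
    α+β≈p = begin
      α + β                  ≈⟨ solve 3 (λ p s h → (p :+ s) :* h :+ (p :- s) :* h := p :* (con (+ 2) :* h))
                                  refl (ι p) s half ⟩
      ι p * (ι (+ 2) * half) ≈⟨ *-congˡ two*half≈1 ⟩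
      ι p * 1#               ≈⟨ *-identityʳ _ ⟩
      ι p                    ∎

    α-β≈s : α - β ≈ s
    α-β≈s = begin
      α - β                  ≈⟨ solve 3 (λ p s h → (p :+ s) :* h :- (p :- s) :* h := s :* (con (+ 2) :* h))
                                  refl (ι p) s half ⟩
      s * (ι (+ 2) * half)   ≈⟨ *-congˡ two*half≈1 ⟩
      s * 1#                 ≈⟨ *-identityʳ _ ⟩
      s                      ∎

    α*β≈-q : α * β ≈ - ι q
    α*β≈-q = begin
      α * β                                          ≈⟨ solve 3 (λ p s h →
         ((p :+ s) :* h) :* ((p :- s) :* h) := (p :* p :- s :* s) :* (h :* h)) refl (ι p) s half ⟩
      (ι p * ι p - s * s) * (half * half)            ≈⟨ *-congʳ (+-congˡ (-‿cong Δ≈)) ⟩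
      (ι p * ι p - (ι p * ι p + ι (+ 4) * ι q)) * (half * half)
                                                     ≈⟨ solve 3 (λ p q h →
         (p :* p :- (p :* p :+ con (+ 4) :* q)) :* (h :* h) := :- (q :* ((con (+ 2) :* h) :* (con (+ 2) :* h))))
         refl (ι p) (ι q) half ⟩
      - (ι q * ((ι (+ 2) * half) * (ι (+ 2) * half))) ≈⟨ -‿cong (*-congˡ (*-cong two*half≈1 two*half≈1)) ⟩
      - (ι q * (1# * 1#))                            ≈⟨ -‿cong (trans (*-congˡ (*-identityʳ 1#)) (*-identityʳ _)) ⟩
      - ι q                                          ∎
      where
      Δ≈ : s * s ≈ ι p * ι p + ι (+ 4) * ι q
      Δ≈ = trans s²≈Δ (trans (ι-+-homo (p ℤ.* p) (+ 4 ℤ.* q)) (+-cong (ι-*-homo p p) (ι-*-homo (+ 4) q)))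

    α-β≉0 : ℤ.0ℤ ℤ.< disc p q → ¬ (α - β ≈ 0#)
    α-β≉0 Δ>0 α-β≈0 = ι-pos≉0 charZero (disc p q) Δ>0
      (trans (sym s²≈Δ) (trans (*-congʳ (trans (sym α-β≈s) α-β≈0)) (zeroˡ s)))

    q≈-αβ : ι q ≈ - (α * β)
    q≈-αβ = trans (sym (-‿involutive _)) (-‿cong (sym α*β≈-q))

    module Horadam (Δ>0 : ℤ.0ℤ ℤ.< disc p q) (a₀ a₁ : ℤ) where
      c A B : Carrier
      c = (α - β) ⁻¹
      A = ι a₁ - ι a₀ * β
      B = ι a₁ - ι a₀ * α

      w : ℕ → Carrier
      w k = ι (horadam p q a₀ a₁ k)

      c*[α-β]≈1 : c * (α - β) ≈ 1#
      c*[α-β]≈1 = trans (*-comm _ _) (⁻¹-inverse (α - β) (α-β≉0 Δ>0))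

      horadam-binet : ∀ k → w k ≈ (c * A) * α ^ k + (- (c * B)) * β ^ k
      horadam-binet = binet w α β (c * A) (- (c * B)) w₀ w₁ recurrence
        where
        via-c*[α-β] : ∀ {x y} → y ≈ x * (c * (α - β)) → x ≈ y
        via-c*[α-β] {x} {y} y≈ = sym (trans y≈ (trans (*-congˡ c*[α-β]≈1) (*-identityʳ x)))

        w₀ : w 0 ≈ c * A + - (c * B)
        w₀ = via-c*[α-β] (solve 5 (λ c a₀ a₁ α β →
          c :* (a₁ :- a₀ :* β) :+ :- (c :* (a₁ :- a₀ :* α)) := a₀ :* (c :* (α :- β)))
          refl c (ι a₀) (ι a₁) α β)

        w₁ : w 1 ≈ (c * A) * α ^ 1 + (- (c * B)) * β ^ 1
        w₁ = via-c*[α-β] (solve 5 (λ c a₀ a₁ α β →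
          (c :* (a₁ :- a₀ :* β)) :* (α :^ 1) :+ (:- (c :* (a₁ :- a₀ :* α))) :* (β :^ 1)
          := a₁ :* (c :* (α :- β)))
          refl c (ι a₀) (ι a₁) α β)

        recurrence : ∀ k → w (suc (suc k)) ≈ (α + β) * w (suc k) - (α * β) * w k
        recurrence k = begin
          ι (p ℤ.* hₖ₊₁ ℤ.+ q ℤ.* hₖ)            ≈⟨ ι-+-homo (p ℤ.* hₖ₊₁) (q ℤ.* hₖ) ⟩
          ι (p ℤ.* hₖ₊₁) + ι (q ℤ.* hₖ)          ≈⟨ +-cong (ι-*-homo p hₖ₊₁) (ι-*-homo q hₖ) ⟩
          ι p * w (suc k) + ι q * w k           ≈⟨ +-cong (*-congʳ (sym α+β≈p)) (*-congʳ q≈-αβ) ⟩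
          (α + β) * w (suc k) + - (α * β) * w k ≈⟨ +-congˡ (-‿distribˡ-* _ _) ⟨
          (α + β) * w (suc k) - (α * β) * w k   ∎
          where
          hₖ hₖ₊₁ : ℤ
          hₖ   = horadam p q a₀ a₁ k
          hₖ₊₁ = horadam p q a₀ a₁ (suc k)

      horadam-binet-shift : ∀ k l → w (k ℕ.+ l) ≈ ((c * A) * α ^ k) * α ^ l + ((- (c * B)) * β ^ k) * β ^ l
      horadam-binet-shift k l = trans (horadam-binet (k ℕ.+ l))
        (+-cong (trans (*-congˡ (^-homo-* α k l)) (sym (*-assoc _ _ _)))
                (trans (*-congˡ (^-homo-* β k l)) (sym (*-assoc _ _ _))))

      absorb-α-β : ∀ P Q X T →
        (α - β) * (((c * A) * (c * A)) * P * X - ((- (c * B)) * (- (c * B))) * Q * T)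
          ≈ c * ((A * A) * P * X - (B * B) * Q * T)
      absorb-α-β P Q X T = begin
        _ ≈⟨ solve 9 (λ c A B α β P Q X T →
               (α :- β) :* (((c :* A) :* (c :* A)) :* P :* X :- ((:- (c :* B)) :* (:- (c :* B))) :* Q :* T)
               := (c :* (α :- β)) :* (c :* ((A :* A) :* P :* X :- (B :* B) :* Q :* T)))
             refl c A B α β P Q X T ⟩
        (c * (α - β)) * (c * ((A * A) * P * X - (B * B) * Q * T)) ≈⟨ *-congʳ c*[α-β]≈1 ⟩
        1# * (c * ((A * A) * P * X - (B * B) * Q * T))           ≈⟨ *-identityˡ _ ⟩
        c * ((A * A) * P * X - (B * B) * Q * T)                  ∎

module SymbolAlgebraProduct {r ℓ} (K : Field r ℓ) (N : ℕ) {{_ : NonZero N}}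
                            (ω a b : Field.Carrier K) where
  open Field K
  open FieldOps K
  open FieldIdentities K using (sumFin-linear)
  open SymbolAlgebra N ω a b
  open IntegerEmbedding K
  open import Algebra.Solver.Ring ℤ.+-*-rawRing (fromCommutativeRing commutativeRing)
    ι-homomorphism ι-≟

  ⊗-linearˡ : ∀ {u U V : S} x y → u ≋ ((x · U) ⊕ (y · V)) →
              ∀ v → (u ⊗ v) ≋ ((x · (U ⊗ v)) ⊕ (y · (V ⊗ v)))
  ⊗-linearˡ {u} {U} {V} x y u≋ v i j =
    linear λ i₁ → linear λ j₁ → linear λ i₂ → linear λ j₂ → termwise i₁ j₁ i₂ j₂
    where
    linear : ∀ {f g h} → (∀ i → f i ≈ x * g i + y * h i) → sumFin N f ≈ x * sumFin N g + y * sumFin N h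
    linear = sumFin-linear N x y
    termwise : ∀ i₁ j₁ i₂ j₂ → let e = basisProd i₁ j₁ i₂ j₂ i j in
      (u i₁ j₁ * v i₂ j₂) * e ≈ x * ((U i₁ j₁ * v i₂ j₂) * e) + y * ((V i₁ j₁ * v i₂ j₂) * e)
    termwise i₁ j₁ i₂ j₂ = trans (*-congʳ (*-congʳ (u≋ i₁ j₁)))
      (solve 6 (λ x y U V v e → ((x :* U :+ y :* V) :* v) :* e
                               := x :* ((U :* v) :* e) :+ y :* ((V :* v) :* e))
         refl x y (U i₁ j₁) (V i₁ j₁) (v i₂ j₂) (basisProd i₁ j₁ i₂ j₂ i j))

  ⊗-linearʳ : ∀ {v U V : S} x y → v ≋ ((x · U) ⊕ (y · V)) →
              ∀ u → (u ⊗ v) ≋ ((x · (u ⊗ U)) ⊕ (y · (u ⊗ V)))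
  ⊗-linearʳ {v} {U} {V} x y v≋ u i j =
    linear λ i₁ → linear λ j₁ → linear λ i₂ → linear λ j₂ → termwise i₁ j₁ i₂ j₂
    where
    linear : ∀ {f g h} → (∀ i → f i ≈ x * g i + y * h i) → sumFin N f ≈ x * sumFin N g + y * sumFin N h
    linear = sumFin-linear N x y
    termwise : ∀ i₁ j₁ i₂ j₂ → let e = basisProd i₁ j₁ i₂ j₂ i j in
      (u i₁ j₁ * v i₂ j₂) * e ≈ x * ((u i₁ j₁ * U i₂ j₂) * e) + y * ((u i₁ j₁ * V i₂ j₂) * e)
    termwise i₁ j₁ i₂ j₂ = trans (*-congʳ (*-congˡ (v≋ i₂ j₂)))
      (solve 6 (λ x y U V u e → (u :* (x :* U :+ y :* V)) :* e
                               := x :* ((u :* U) :* e) :+ y :* ((u :* V) :* e))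
         refl x y (U i₂ j₂) (V i₂ j₂) (u i₁ j₁) (basisProd i₁ j₁ i₂ j₂ i j))

  ⊗-bilinear : ∀ {u v U V : S} x₁ y₁ x₂ y₂ →
    u ≋ ((x₁ · U) ⊕ (y₁ · V)) → v ≋ ((x₂ · U) ⊕ (y₂ · V)) →
    ∀ i j → (u ⊗ v) i j ≈ ((x₁ * x₂) * (U ⊗ U) i j + (x₁ * y₂) * (U ⊗ V) i j)
                        + ((y₁ * x₂) * (V ⊗ U) i j + (y₁ * y₂) * (V ⊗ V) i j)
  ⊗-bilinear {u} {v} {U} {V} x₁ y₁ x₂ y₂ u≋ v≋ i j = begin
    (u ⊗ v) i j                                     ≈⟨ ⊗-linearˡ x₁ y₁ u≋ v i j ⟩
    x₁ * (U ⊗ v) i j + y₁ * (V ⊗ v) i j             ≈⟨ +-cong (*-congˡ (⊗-linearʳ x₂ y₂ v≋ U i j))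
                                                               (*-congˡ (⊗-linearʳ x₂ y₂ v≋ V i j)) ⟩
    x₁ * (x₂ * (U ⊗ U) i j + y₂ * (U ⊗ V) i j)
      + y₁ * (x₂ * (V ⊗ U) i j + y₂ * (V ⊗ V) i j)  ≈⟨ solve 8 (λ x₁ y₁ x₂ y₂ UU UV VU VV →
         x₁ :* (x₂ :* UU :+ y₂ :* UV) :+ y₁ :* (x₂ :* VU :+ y₂ :* VV)
         := ((x₁ :* x₂) :* UU :+ (x₁ :* y₂) :* UV) :+ ((y₁ :* x₂) :* VU :+ (y₁ :* y₂) :* VV))
         refl x₁ y₁ x₂ y₂ ((U ⊗ U) i j) ((U ⊗ V) i j) ((V ⊗ U) i j) ((V ⊗ V) i j) ⟩
    ((x₁ * x₂) * (U ⊗ U) i j + (x₁ * y₂) * (U ⊗ V) i j)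
      + ((y₁ * x₂) * (V ⊗ U) i j + (y₁ * y₂) * (V ⊗ V) i j) ∎
    where open import Relation.Binary.Reasoning.Setoid setoid

theorem3p14 : ∀ {c ℓ : Level} (K : Field c ℓ) →
    let open Field K
        open FieldOps K
    in CharZero →
       (p q a₀ a₁ : ℤ) → ℤ.0ℤ ℤ.< disc p q →
       -- s plays the role of √Δ ∈ ℝ ⊆ K
       (s : Carrier) → (s * s) ≈ ι (disc p q) →
       (N : ℕ) → {{_ : NonZero N}} →
       (ω a b : Carrier) → PrimitiveRoot N ω →
       ¬ (a ≈ 0#) → ¬ (b ≈ 0#) →
       let open SymbolAlgebra N ω a b
           two = 1# + 1#
           α = (ι p + s) * (two ⁻¹)
           β = (ι p - s) * (two ⁻¹)
           A = ι a₁ - ι a₀ * β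
           B = ι a₁ - ι a₀ * α
           w = λ k → ι (horadam p q a₀ a₁ k)
           W = λ k → fromSeq (λ l → w (k ℕ.+ l))
           α̲ = fromSeq (λ l → α ^ l)
           β̲ = fromSeq (λ l → β ^ l)
       in (m n : ℕ) → 1 ℕ.≤ m → 1 ℕ.≤ n →
          ((W m ⊗ W (ℕ.suc n)) ⊕ (ι q · (W (m ℕ.∸ 1) ⊗ W n)))
            ≋ (((α - β) ⁻¹) ·
                ((((A * A) * (α ^ (m ℕ.+ n))) · (α̲ ⊗ α̲))
                  ⊖ (((B * B) * (β ^ (m ℕ.+ n))) · (β̲ ⊗ β̲))))
theorem3p14 K charZero p q a₀ a₁ Δ>0 s s²≈Δ N ω a b _ _ _ (suc m) n _ _ i j = begin
  (W (suc m) ⊗ W (suc n)) i j + ι q * (W m ⊗ W n) i j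
    ≈⟨ +-cong (⊗-bilinear _ _ _ _ (W≋ (suc m)) (W≋ (suc n)) i j)
              (*-cong q≈-αβ (⊗-bilinear _ _ _ _ (W≋ m) (W≋ n) i j)) ⟩
  _ ≈⟨ binet-product-identity α β x y ((α̲ ⊗ α̲) i j) ((α̲ ⊗ β̲) i j) ((β̲ ⊗ α̲) i j) ((β̲ ⊗ β̲) i j) m n ⟩
  _ ≈⟨ absorb-α-β (α ^ (suc m ℕ.+ n)) (β ^ (suc m ℕ.+ n)) ((α̲ ⊗ α̲) i j) ((β̲ ⊗ β̲) i j) ⟩
  _ ∎
  where
  open Field K
  open FieldOps K
  open SymbolAlgebra N ω a b
  open FieldIdentities K
  open QuadraticRoots charZero p q s s²≈Δ
  open Horadam Δ>0 a₀ a₁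
  open SymbolAlgebraProduct K N ω a b
  open import Relation.Binary.Reasoning.Setoid setoid
  x y : Carrier
  x = c * A
  y = - (c * B)
  α̲ β̲ : S
  α̲ = fromSeq (α ^_)
  β̲ = fromSeq (β ^_)
  W : ℕ → S
  W k = fromSeq (λ l → w (k ℕ.+ l))
  W≋ : ∀ k → W k ≋ (((x * α ^ k) · α̲) ⊕ ((y * β ^ k) · β̲))
  W≋ k i j = horadam-binet-shift k _
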